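{- Let $G=(V,E)$ be a finite loopless multigraph, $K\subseteq V$ with $|K|\ge2$, and $(G^1,G^2,X)$ a $K$-splitting of $(G,K)$. Then \[ M(G,K)=M(G^1_X,K^1_X)\,M(G^2_X,K^2_X)\sum_{\sigma_1,\sigma_2\in\Pi_l(X,\pi_X)}D(G^1,\sigma_1)\,m(\sigma_1\vee\sigma_2)\,D(G^2,\sigma_2). \]
   Context: Labelled set partitions: for a finite set $Y$ and a symbol $l\notin Y$, a labelled set partition of $Y$ is $\pi=\{B_1\cup L_1,\dots,B_k\cup L_k\}$ with $\{B_1,\dots,B_k\}$ a set partition of $Y$ and $L_i\in\{\emptyset,\{l\}\}$ (labelled block iff $L_i=\{l\}$). $\Pi_l(Y)$ is the set of these, ordered by $\sigma\le\pi$ iff every block of $\sigma$ (including $l$ if present) is contained in a block of $\pi$; it is a lattice with join $\vee$. $m(\pi)=1$ if $\pi$ has exactly one labelled block, else $0$. Restriction: for $\pi\in\Pi_l(W)$ and $Y\subseteq W$, $\pi\sqcap Y\in\Pi_l(Y)$ has the blocks $(B\cap Y)\cup L$ for the blocks $B\cup L$ of $\pi$ with $B\cap Y\ne\emptyset$. Graphs may have parallel edges but no loops. For a graph $H$ on vertex set $W$ and $K'\subseteq W$: $M(H,K')=1$ if all vertices of $K'$ lie in one connected component of $H$, else $0$; $\{(H,K')\}\in\Pi_l(W)$ is the labelled set partition whose blocks are the vertex sets of the connected components of $H$, a block labelled iff it meets $K'$. For $Y\subseteq W$, $H_Y$ is obtained by identifying all vertices of $Y$ into a single vertex (called $Y$),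 deleting edges with both endpoints in $Y$ and keeping all other edges. $K$-splitting: $G^i=(V^i,E^i)$ subgraphs of $G$ with $E^1\cup E^2=E$, $E^1\cap E^2=\emptyset$, $V^1\cup V^2=V$, $V^1\cap V^2=X$, and $K^i:=K\cap V^i\ne\emptyset$ ($i=1,2$). $K^i_X=(K^i\setminus X)\cup\{X\}$ (terminal set in $G^i_X$). $D(G^i,\pi)=1$ if $\{(G^i,K^i)\}\sqcap X=\pi$ and $0$ otherwise. $\pi_X\in\Pi_l(X)$ is the partition of $X$ into singletons $\{x\}$, labelled iff $x\in K$, and $\Pi_l(X,\pi_X)=\{\pi\in\Pi_l(X):\pi\ge\pi_X,\ \pi\text{ has at least one labelled block}\}$. -}

module Defs where

open import Data.Nat using (ℕ; zero; suc; _+_; _*_)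
open import Data.Bool using (Bool; true; false; _∧_; _∨_; not; if_then_else_; T)
open import Data.Fin using (Fin; zero; suc)
open import Data.Fin.Properties using (_≟_)
open import Data.Product using (_×_; _,_; Σ; ∃; ∃-syntax; proj₁; proj₂)
open import Data.List using (List; []; _∷_; map; filter; _++_)
open import Data.List.Relation.Unary.All using (All)
open import Data.List.Relation.Binary.Permutation.Propositional using (_↭_)
open import Relation.Nullary.Decidable using (⌊_⌋)
open import Relation.Binary.PropositionalEquality using (_≡_; _≢_)
import Data.Vec.Functional as VF

Sub : ℕ → Set
Sub n = Fin n → Bool

BRel : ℕ → Set
BRel n = Fin n → Fin n → Bool

_==_ : ∀ {n} → Fin n → Fin n → Bool
x == y = ⌊ x ≟ y ⌋

anyFin : ∀ {n} → (Fin n → Bool) → Bool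
anyFin {zero}  p = false
anyFin {suc n} p = p zero ∨ anyFin (λ i → p (suc i))

allFin : ∀ {n} → (Fin n → Bool) → Bool
allFin {zero}  p = true
allFin {suc n} p = p zero ∧ allFin (λ i → p (suc i))

_⇒ᵇ_ : Bool → Bool → Bool
a ⇒ᵇ b = not a ∨ b

⟦_⟧ : Bool → ℕ
⟦ b ⟧ = if b then 1 else 0

-- R∪ B ∪ B² ∪ … ∪ B^(k+1) : pairs joined by a B-chain of length between 1 and k+1
chain : ∀ {n} → ℕ → BRel n → BRel n
chain zero    B = B
chain (suc k) B x z = chain k B x z ∨ anyFin (λ y → chain k B x y ∧ B y z)

-- transitive closure (chains of length ≤ n suffice on an n-element universe)
tclo : ∀ {n} → BRel n → BRel n
tclo {n} B = chain n B

-- Finite loopless multigraphs, with vertex set a subset of the universe Fin n.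
-- Edges form a list (so parallel edges = repeated entries).

record Graph (n : ℕ) : Set where
  constructor graph
  field
    V : Sub n
    E : List (Fin n × Fin n)
open Graph public

IsGraph : ∀ {n} → Graph n → Set
IsGraph G = All (λ e → T (V G (proj₁ e)) × T (V G (proj₂ e)) × proj₁ e ≢ proj₂ e) (E G)

anyList : ∀ {A : Set} → (A → Bool) → List A → Bool
anyList p []       = false
anyList p (a ∷ as) = p a ∨ anyList p as

adj : ∀ {n} → Graph n → BRel n
adj G x y = anyList (λ e → (x == proj₁ e ∧ y == proj₂ e) ∨ (x == proj₂ e ∧ y == proj₁ e)) (E G)

conn : ∀ {n} → Graph n → BRel n
conn G = tclo (λ x y → (V G x ∧ x == y) ∨ adj G x y)

M : ∀ {n} → Graph n → Sub n → ℕ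
M H K′ = ⟦ allFin (λ x → allFin (λ y → (K′ x ∧ K′ y) ⇒ᵇ conn H x y)) ⟧

-- H_Y : identify all vertices of Y into the new vertex  zero  (= "Y");
-- a vertex x ∉ Y becomes suc x; edges inside Y are deleted.
cmap : ∀ {n} → Sub n → Fin n → Fin (suc n)
cmap Y x = if Y x then zero else suc x

contract : ∀ {n} → Graph n → Sub n → Graph (suc n)
contract H Y = graph V′ E′
  where
    V′ : Sub _
    V′ zero    = true
    V′ (suc x) = V H x ∧ not (Y x)
    E′ = map (λ e → cmap Y (proj₁ e) , cmap Y (proj₂ e))
             (filter (λ e → Data.Bool._≟_ (Y (proj₁ e) ∧ Y (proj₂ e)) false) (E H))

-- terminal set in H_Y: (K' \ Y) ∪ {Y}
termX : ∀ {n} → Sub n → Sub n → Sub (suc n)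
termX K′ Y zero    = true
termX K′ Y (suc x) = K′ x ∧ not (Y x)

-- Labelled set partitions of Y ⊆ Fin n.
-- Encoded as (R , L): R x y = "x and y in the same block", L x = "the block
-- of x is labelled (contains l)". Each labelled set partition has exactly one code.

LP : ℕ → Set
LP n = BRel n × Sub n

isLP : ∀ {n} → Sub n → LP n → Bool
isLP Y (R , L) =
  allFin (λ x → allFin (λ y → R x y ⇒ᵇ (Y x ∧ Y y)))
  ∧ allFin (λ x → Y x ⇒ᵇ R x x)
  ∧ allFin (λ x → allFin (λ y → R x y ⇒ᵇ R y x))
  ∧ allFin (λ x → allFin (λ y → allFin (λ z → (R x y ∧ R y z) ⇒ᵇ R x z)))
  ∧ allFin (λ x → L x ⇒ᵇ Y x)
  ∧ allFin (λ x → allFin (λ y → R x y ⇒ᵇ (L x ⇒ᵇ L y)))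

_≤ᴸ_ : ∀ {n} → LP n → LP n → Bool
(R₁ , L₁) ≤ᴸ (R₂ , L₂) =
  allFin (λ x → allFin (λ y → R₁ x y ⇒ᵇ R₂ x y)) ∧ allFin (λ x → L₁ x ⇒ᵇ L₂ x)

_∨ᴸ_ : ∀ {n} → LP n → LP n → LP n
(R₁ , L₁) ∨ᴸ (R₂ , L₂) = R , L
  where
    R = tclo (λ x y → R₁ x y ∨ R₂ x y)
    L = λ x → anyFin (λ y → R x y ∧ (L₁ y ∨ L₂ y))

m : ∀ {n} → LP n → ℕ
m (R , L) = ⟦ anyFin L ∧ allFin (λ x → allFin (λ y → (L x ∧ L y) ⇒ᵇ R x y)) ⟧

_=ᴸ_ : ∀ {n} → LP n → LP n → Bool
(R₁ , L₁) =ᴸ (R₂ , L₂) =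
  allFin (λ x → allFin (λ y → Data.Bool._≟_ (R₁ x y) (R₂ x y) |> ⌊_⌋))
  ∧ allFin (λ x → ⌊ Data.Bool._≟_ (L₁ x) (L₂ x) ⌋)
  where
    _|>_ : ∀ {A B : Set} → A → (A → B) → B
    a |> f = f a

_⊓_ : ∀ {n} → LP n → Sub n → LP n
(R , L) ⊓ Y = (λ x y → R x y ∧ Y x ∧ Y y) , (λ x → L x ∧ Y x)

-- {(H,K')} : blocks = components of H, labelled iff they meet K'
compLP : ∀ {n} → Graph n → Sub n → LP n
compLP H K′ = (λ x y → V H x ∧ V H y ∧ conn H x y)
            , (λ x → V H x ∧ anyFin (λ y → K′ y ∧ conn H x y))

SumOver : Set → Set
SumOver A = (A → ℕ) → ℕ

sumBool : SumOver Bool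
sumBool f = f false + f true

sumFun : ∀ {A : Set} → SumOver A → (k : ℕ) → SumOver (Fin k → A)
sumFun s zero    f = f (λ ())
sumFun s (suc k) f = s (λ a → sumFun s k (λ g → f (a VF.∷ g)))

sumLP : ∀ {n} → SumOver (LP n)
sumLP {n} f = sumFun (sumFun sumBool n) n (λ R → sumFun sumBool n (λ L → f (R , L)))

_∩_ : ∀ {n} → Sub n → Sub n → Sub n
(A ∩ B) x = A x ∧ B x

_⊆_ : ∀ {n} → Sub n → Sub n → Set
A ⊆ B = ∀ x → T (A x) → T (B x)

record KSplitting {n : ℕ} (G : Graph n) (K : Sub n) (G¹ G² : Graph n) (X : Sub n) : Set where
  field
    graph¹  : IsGraph G¹
    graph²  : IsGraph G²
    sub¹    : V G¹ ⊆ V G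
    sub²    : V G² ⊆ V G
    edges   : E G ↭ (E G¹ ++ E G²)          -- E¹ ∪ E² = E, E¹ ∩ E² = ∅
    vunion  : ∀ x → V G x ≡ (V G¹ x ∨ V G² x)
    vinter  : ∀ x → X x ≡ (V G¹ x ∧ V G² x)
    K¹-ne   : ∃[ x ] T ((K ∩ V G¹) x)
    K²-ne   : ∃[ x ] T ((K ∩ V G²) x)

D : ∀ {n} → Graph n → Sub n → Sub n → LP n → ℕ
D Gi K X σ = ⟦ (compLP Gi (K ∩ V Gi) ⊓ X) =ᴸ σ ⟧

πX : ∀ {n} → Sub n → Sub n → LP n
πX K X = (λ x y → X x ∧ x == y) , (λ x → X x ∧ K x)

inΠX : ∀ {n} → Sub n → Sub n → LP n → Bool
inΠX K X σ = isLP X σ ∧ (πX K X ≤ᴸ σ) ∧ anyFin (proj₂ σ)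

splitSum : ∀ {n} → Graph n → Graph n → Sub n → Sub n → ℕ
splitSum G¹ G² K X =
  sumLP (λ σ₁ → sumLP (λ σ₂ →
    ⟦ inΠX K X σ₁ ∧ inΠX K X σ₂ ⟧ * (D G¹ K X σ₁ * m (σ₁ ∨ᴸ σ₂) * D G² K X σ₂)))

module Submission where

-- Since D(Gⁱ,σ) is the indicator of σ = ρᵢ := {(Gⁱ,Kⁱ)} ⊓ X, the double sum
-- collapses to [ρ₁, ρ₂ ∈ Π_l(X,π_X)] · m(ρ₁ ∨ ρ₂)  (splitSum-collapse).  What
-- remains is combinatorial (Connectivity.M-factorises): K is connected in G
-- iff the terminals of both contractions Gⁱ_X are connected and ρ₁ ∨ ρ₂ has a
-- single labelled block.  Both directions rest on the fact that a walk of G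
-- between points of X splits at X into walks inside G¹ or G², so two points
-- of X are joined in G iff they share a block of ρ₁ ∨ ρ₂.

open import Defs
open import Data.Nat using (ℕ; zero; suc; _+_; _*_; _∸_; _≤_; _<_; z≤n; s≤s)
open import Data.Nat.Properties
  using (≤-refl; ≤-trans; ≤-total; m∸n+n≡m; n≤1+n; <-irrefl; <-≤-trans; +-identityʳ; *-identityˡ)
open import Data.Nat.Solver using (module +-*-Solver)
open import Data.Bool using (Bool; true; false; _∧_; _∨_; not; T)
import Data.Bool as Bool
open import Data.Bool.Properties using (T-≡; T-not-≡)
open import Function.Bundles using (Equivalence)
open import Data.Unit using (tt)
open import Data.Empty using (⊥-elim)
open import Data.Fin using (Fin; zero; suc)
open import Data.Fin.Properties using (suc-injective)
open import Data.Fin.Subset using (Subset; ∣_∣) renaming (_∈_ to _∈ˢ_)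
open import Data.Fin.Subset.Properties using (∣p∣≤n; p⊂q⇒∣p∣<∣q∣)
open import Data.Vec using (tabulate)
open import Data.Vec.Properties using (lookup∘tabulate; lookup⇒[]=; []=⇒lookup)
open import Data.Product using (_×_; _,_; Σ; ∃; proj₁; proj₂)
open import Data.Sum using (_⊎_; inj₁; inj₂; swap)
open import Relation.Nullary using (¬_; Dec)
open import Relation.Nullary.Decidable using (⌊_⌋; toWitness; fromWitness)
import Data.Vec.Functional as VF
open import Relation.Binary.PropositionalEquality
  using (_≡_; _≢_; refl; sym; trans; cong; cong₂; subst; subst₂; module ≡-Reasoning)
open import Relation.Binary.Construct.Closure.Transitive
  using (TransClosure; [_]; _∷_; _∷ʳ_; _++_; symmetric)
open import Data.List using (List; _∷_)
open import Data.List.Membership.Propositional using (_∈_)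
open import Data.List.Membership.Propositional.Properties
  using (∈-map⁺; ∈-map⁻; ∈-filter⁺; ∈-filter⁻; ∈-++⁻; ∈-++⁺ˡ; ∈-++⁺ʳ)
open import Data.List.Relation.Unary.Any using (here; there)
open import Data.List.Relation.Unary.All using () renaming (lookup to All-lookup)
open import Data.List.Relation.Binary.Permutation.Propositional using (↭-sym)
open import Data.List.Relation.Binary.Permutation.Propositional.Properties using (∈-resp-↭)

∧-intro : ∀ {a b} → T a → T b → T (a ∧ b)
∧-intro {true} _ t = t

∧-elim : ∀ {a b} → T (a ∧ b) → T a × T b
∧-elim {true} t = tt , t

∨-introˡ : ∀ {a} b → T a → T (a ∨ b)
∨-introˡ {true} _ _ = tt

∨-introʳ : ∀ a {b} → T b → T (a ∨ b)
∨-introʳ true  _ = tt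
∨-introʳ false t = t

∨-elim : ∀ {a b} → T (a ∨ b) → T a ⊎ T b
∨-elim {true}  _ = inj₁ tt
∨-elim {false} t = inj₂ t

⇒-intro : ∀ {a b} → (T a → T b) → T (a ⇒ᵇ b)
⇒-intro {true}  f = f tt
⇒-intro {false} _ = tt

⇒-elim : ∀ {a b} → T (a ⇒ᵇ b) → T a → T b
⇒-elim {true} t _ = t

not-intro : ∀ {a} → ¬ T a → T (not a)
not-intro {true}  f = f tt
not-intro {false} _ = tt

not-elim : ∀ {a} → T (not a) → ¬ T a
not-elim {true} ()

T? : ∀ a → T a ⊎ ¬ T a
T? true  = inj₁ tt
T? false = inj₂ λ ()

T-ext : ∀ {a b} → (T a → T b) → (T b → T a) → a ≡ b
T-ext {true}  {true}  _ _ = refl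
T-ext {true}  {false} f _ = ⊥-elim (f tt)
T-ext {false} {true}  _ g = ⊥-elim (g tt)
T-ext {false} {false} _ _ = refl

⟦⟧-∧ : ∀ a b → ⟦ a ∧ b ⟧ ≡ ⟦ a ⟧ * ⟦ b ⟧
⟦⟧-∧ true  true  = refl
⟦⟧-∧ true  false = refl
⟦⟧-∧ false _     = refl

⟦⟧-factorise : ∀ {a b c d e} → (T a → T b × T c × T d × T e) → (T b × T c × T d × T e → T a) →
               ⟦ a ⟧ ≡ ⟦ b ⟧ * ⟦ c ⟧ * (⟦ d ⟧ * ⟦ e ⟧)
⟦⟧-factorise {a} {b} {c} {d} {e} to from = begin
  ⟦ a ⟧                     ≡⟨ cong ⟦_⟧ (T-ext to′ from′) ⟩
  ⟦ (b ∧ c) ∧ (d ∧ e) ⟧     ≡⟨ ⟦⟧-∧ (b ∧ c) (d ∧ e) ⟩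
  ⟦ b ∧ c ⟧ * ⟦ d ∧ e ⟧     ≡⟨ cong₂ _*_ (⟦⟧-∧ b c) (⟦⟧-∧ d e) ⟩
  ⟦ b ⟧ * ⟦ c ⟧ * (⟦ d ⟧ * ⟦ e ⟧) ∎
  where
    open ≡-Reasoning
    to′ : T a → T ((b ∧ c) ∧ (d ∧ e))
    to′ t = let (tb , tc , td , te) = to t in ∧-intro (∧-intro tb tc) (∧-intro td te)
    from′ : T ((b ∧ c) ∧ (d ∧ e)) → T a
    from′ t = let (bc , de) = ∧-elim {b ∧ c} t
                  (tb , tc) = ∧-elim {b} bc
                  (td , te) = ∧-elim {d} de
              in from (tb , tc , td , te)

==-sound : ∀ {n} {x y : Fin n} → T (x == y) → x ≡ y
==-sound = toWitness

==-refl : ∀ {n} (x : Fin n) → T (x == x)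
==-refl _ = fromWitness refl

allFin-intro : ∀ {n} {p : Fin n → Bool} → (∀ i → T (p i)) → T (allFin p)
allFin-intro {zero}  _ = tt
allFin-intro {suc n} f = ∧-intro (f zero) (allFin-intro (λ i → f (suc i)))

allFin-elim : ∀ {n} {p : Fin n → Bool} → T (allFin p) → ∀ i → T (p i)
allFin-elim {suc n} t zero    = proj₁ (∧-elim t)
allFin-elim {suc n} t (suc i) = allFin-elim (proj₂ (∧-elim t)) i

all²-intro : ∀ {n} {p : Fin n → Fin n → Bool} →
             (∀ i j → T (p i j)) → T (allFin (λ i → allFin (p i)))
all²-intro f = allFin-intro (λ i → allFin-intro (f i))

all²-elim : ∀ {n} {p : Fin n → Fin n → Bool} →
            T (allFin (λ i → allFin (p i))) → ∀ i j → T (p i j)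
all²-elim t i = allFin-elim (allFin-elim t i)

anyFin-intro : ∀ {n} {p : Fin n → Bool} i → T (p i) → T (anyFin p)
anyFin-intro         zero    t = ∨-introˡ _ t
anyFin-intro {p = p} (suc i) t = ∨-introʳ (p zero) (anyFin-intro i t)

anyFin-elim : ∀ {n} {p : Fin n → Bool} → T (anyFin p) → ∃ λ i → T (p i)
anyFin-elim {suc n} {p} t with ∨-elim {p zero} t
... | inj₁ t₀ = zero , t₀
... | inj₂ t′ with anyFin-elim t′
...   | i , tᵢ = suc i , tᵢ

anyFin-dec : ∀ {n} (p : Fin n → Bool) → (∃ λ i → T (p i)) ⊎ (∀ i → ¬ T (p i))
anyFin-dec p with T? (anyFin p)
... | inj₁ t = inj₁ (anyFin-elim t)
... | inj₂ f = inj₂ λ i tᵢ → f (anyFin-intro i tᵢ)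

anyFin-cong : ∀ {n} {p q : Fin n → Bool} → (∀ i → p i ≡ q i) → anyFin p ≡ anyFin q
anyFin-cong {zero}  _ = refl
anyFin-cong {suc n} e = cong₂ _∨_ (e zero) (anyFin-cong (λ i → e (suc i)))

allFin-cong : ∀ {n} {p q : Fin n → Bool} → (∀ i → p i ≡ q i) → allFin p ≡ allFin q
allFin-cong {zero}  _ = refl
allFin-cong {suc n} e = cong₂ _∧_ (e zero) (allFin-cong (λ i → e (suc i)))

∈-tabulate⁺ : ∀ {n} {p : Sub n} {x} → T (p x) → x ∈ˢ tabulate p
∈-tabulate⁺ {p = p} {x} t =
  lookup⇒[]= x (tabulate p) (trans (lookup∘tabulate p x) (Equivalence.to T-≡ t))

∈-tabulate⁻ : ∀ {n} {p : Sub n} {x} → x ∈ˢ tabulate p → T (p x)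
∈-tabulate⁻ {p = p} {x} m =
  Equivalence.from T-≡ (trans (sym (lookup∘tabulate p x)) ([]=⇒lookup m))

tabulate-grows : ∀ {n} {p q : Sub n} → (∀ i → T (p i) → T (q i)) →
                 ∀ j → T (q j) → ¬ T (p j) → ∣ tabulate p ∣ < ∣ tabulate q ∣
tabulate-grows p⊆q j qj ¬pj =
  p⊂q⇒∣p∣<∣q∣ ( (λ m → ∈-tabulate⁺ (p⊆q _ (∈-tabulate⁻ m)))
              , j , ∈-tabulate⁺ qj , (λ m → ¬pj (∈-tabulate⁻ m)) )

-- Walks of length k+1 are captured by chain k; tclo takes k = n, which
-- suffices because the set of vertices reached from x grows strictly until it
-- stabilises, and it has at most n elements.

module Closure {n : ℕ} (B : BRel n) where

  Walk : Fin n → Fin n → Set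
  Walk = TransClosure (λ x y → T (B x y))

  chain-sound : ∀ k {x z} → T (chain k B x z) → Walk x z
  chain-sound zero    t = [ t ]
  chain-sound (suc k) {x} {z} t with ∨-elim {chain k B x z} t
  ... | inj₁ c = chain-sound k c
  ... | inj₂ c with anyFin-elim {p = λ y → chain k B x y ∧ B y z} c
  ...   | y , c′ with ∧-elim {chain k B x y} c′
  ...     | xy , yz = chain-sound k xy ∷ʳ yz

  chain-weaken : ∀ k {x z} → T (chain k B x z) → T (chain (suc k) B x z)
  chain-weaken k t = ∨-introˡ _ t

  -- chain is defined by appending steps; this is the corresponding prepend rule.
  chain-cons : ∀ k {x y z} → T (B x y) → T (chain k B y z) → T (chain (suc k) B x z)
  chain-cons zero    {x} {y} {z} b c = ∨-introʳ (B x z) (anyFin-intro y (∧-intro b c))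
  chain-cons (suc k) {x} {y} {z} b c with ∨-elim {chain k B y z} c
  ... | inj₁ c′ = chain-weaken (suc k) (chain-cons k b c′)
  ... | inj₂ c′ with anyFin-elim {p = λ w → chain k B y w ∧ B w z} c′
  ...   | w , d with ∧-elim {chain k B y w} d
  ...     | yw , wz = ∨-introʳ (chain (suc k) B x z) (anyFin-intro w (∧-intro (chain-cons k b yw) wz))

  chain-complete : ∀ {x z} → Walk x z → ∃ λ k → T (chain k B x z)
  chain-complete [ b ]   = 0 , b
  chain-complete (b ∷ w) with chain-complete w
  ... | k , c = suc k , chain-cons k b c

  chain-mono : ∀ {k j x z} → k ≤ j → T (chain k B x z) → T (chain j B x z)
  chain-mono {k} {j} {x} {z} k≤j t =
    subst (λ i → T (chain i B x z)) (m∸n+n≡m k≤j) (weaken-by (j ∸ k) t)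
    where
      weaken-by : ∀ d → T (chain k B x z) → T (chain (d + k) B x z)
      weaken-by zero    c = c
      weaken-by (suc d) c = chain-weaken (d + k) (weaken-by d c)

  reach : ℕ → Fin n → Subset n
  reach k x = tabulate (chain k B x)

  Stable : Fin n → ℕ → Set
  Stable x k = ∀ z → chain (suc k) B x z ≡ chain k B x z

  stable-forever : ∀ {x i} → Stable x i → ∀ d z → chain (d + i) B x z ≡ chain i B x z
  stable-forever st zero    z = refl
  stable-forever {x} {i} st (suc d) z =
    trans (cong₂ _∨_ (stable-forever st d z)
                     (anyFin-cong (λ y → cong (_∧ B y z) (stable-forever st d y))))
          (st z)

  stable-or-grows : ∀ x k → Stable x k ⊎ ∣ reach k x ∣ < ∣ reach (suc k) x ∣
  stable-or-grows x k with anyFin-dec (λ z → chain (suc k) B x z ∧ not (chain k B x z))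
  ... | inj₁ (z , t) =
    let (new , ¬old) = ∧-elim t
    in inj₂ (tabulate-grows (λ i → chain-weaken k) z new (not-elim ¬old))
  ... | inj₂ none = inj₁ λ z → T-ext (shrink z) (chain-weaken k)
    where
      shrink : ∀ z → T (chain (suc k) B x z) → T (chain k B x z)
      shrink z t with T? (chain k B x z)
      ... | inj₁ old  = old
      ... | inj₂ ¬old = ⊥-elim (none z (∧-intro t (not-intro ¬old)))

  stable-or-large : ∀ x k → (∃ λ i → i ≤ k × Stable x i) ⊎ k < ∣ reach (suc k) x ∣
  stable-or-large x zero with stable-or-grows x zero
  ... | inj₁ st   = inj₁ (0 , z≤n , st)
  ... | inj₂ grow = inj₂ (<-≤-trans (s≤s z≤n) grow)
  stable-or-large x (suc k) with stable-or-large x k | stable-or-grows x (suc k)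
  ... | inj₁ (i , i≤k , st) | _        = inj₁ (i , ≤-trans i≤k (n≤1+n k) , st)
  ... | inj₂ large          | inj₁ st  = inj₁ (suc k , ≤-refl , st)
  ... | inj₂ large          | inj₂ grow = inj₂ (<-≤-trans (s≤s large) grow)

  stable-within-n : ∀ x → ∃ λ i → i ≤ n × Stable x i
  stable-within-n x with stable-or-large x n
  ... | inj₁ found = found
  ... | inj₂ large = ⊥-elim (<-irrefl refl (<-≤-trans large (∣p∣≤n (reach (suc n) x))))

  tclo-sound : ∀ {x z} → T (tclo B x z) → Walk x z
  tclo-sound = chain-sound n

  tclo-complete : ∀ {x z} → Walk x z → T (tclo B x z)
  tclo-complete {x} {z} w with chain-complete w | stable-within-n x
  ... | k , c | i , i≤n , st = chain-mono i≤n (within-stable k c)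
    where
      within-stable : ∀ k → T (chain k B x z) → T (chain i B x z)
      within-stable k c with ≤-total k i
      ... | inj₁ k≤i = chain-mono k≤i c
      ... | inj₂ i≤k = subst T (trans (cong (λ j → chain j B x z) (sym (m∸n+n≡m i≤k)))
                                      (stable-forever st (k ∸ i) z)) c

record Selective {A : Set} (s : SumOver A) (eq : A → A → Bool) : Set where
  field
    sum-cong   : ∀ {f g : A → ℕ} → (∀ a → f a ≡ g a) → s f ≡ s g
    sum-zero   : s (λ _ → 0) ≡ 0
    sum-select : ∀ r (f : A → ℕ) → ∃ λ a′ → T (eq r a′) × s (λ a → ⟦ eq r a ⟧ * f a) ≡ f a′

  sum-indicator : ∀ b (f : A → ℕ) → s (λ a → ⟦ b ⟧ * f a) ≡ ⟦ b ⟧ * s f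
  sum-indicator true  f = trans (sum-cong (λ a → *-identityˡ (f a))) (sym (*-identityˡ (s f)))
  sum-indicator false f = sum-zero

  sum-select-at : ∀ r (f : A → ℕ) → (∀ a → T (eq r a) → f r ≡ f a) →
                  s (λ a → ⟦ eq r a ⟧ * f a) ≡ f r
  sum-select-at r f resp with sum-select r f
  ... | a′ , ra′ , picked = trans picked (sym (resp a′ ra′))

⟦⟧-∧-* : ∀ a b x → ⟦ a ∧ b ⟧ * x ≡ ⟦ a ⟧ * (⟦ b ⟧ * x)
⟦⟧-∧-* true  b x = sym (+-identityʳ (⟦ b ⟧ * x))
⟦⟧-∧-* false b x = refl

eqBool : Bool → Bool → Bool
eqBool a b = ⌊ a Bool.≟ b ⌋

sumBool-selective : Selective sumBool eqBool
sumBool-selective = record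
  { sum-cong   = λ e → cong₂ _+_ (e false) (e true)
  ; sum-zero   = refl
  ; sum-select = select }
  where
    select : ∀ r f → ∃ λ a′ → T (eqBool r a′) × sumBool (λ a → ⟦ eqBool r a ⟧ * f a) ≡ f a′
    select false f = false , tt , trans (+-identityʳ _) (+-identityʳ (f false))
    select true  f = true , tt , +-identityʳ (f true)

eqFun : ∀ {A : Set} → (A → A → Bool) → (k : ℕ) → (Fin k → A) → (Fin k → A) → Bool
eqFun eq k h h′ = allFin (λ i → eq (h i) (h′ i))

sumFun-selective : ∀ {A : Set} {s : SumOver A} {eq : A → A → Bool} →
                   Selective s eq → ∀ k → Selective (sumFun s k) (eqFun eq k)
sumFun-selective S zero = record
  { sum-cong   = λ e → e _
  ; sum-zero   = refl
  ; sum-select = λ r f → (λ ()) , tt , +-identityʳ _ }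
sumFun-selective {s = s} {eq} S (suc k) = record
  { sum-cong   = λ e → S.sum-cong (λ a → IH.sum-cong (λ g → e (a VF.∷ g)))
  ; sum-zero   = trans (S.sum-cong (λ _ → IH.sum-zero)) S.sum-zero
  ; sum-select = select }
  where
    module S  = Selective S
    module IH = Selective (sumFun-selective S k)

    -- Condition on the head first, then on the tail.
    select : ∀ r f → ∃ λ h → T (eqFun eq (suc k) r h) ×
             sumFun s (suc k) (λ h → ⟦ eqFun eq (suc k) r h ⟧ * f h) ≡ f h
    select r f with S.sum-select (r zero) (λ a → sumFun s k (λ g → ⟦ eqFun eq k (λ i → r (suc i)) g ⟧ * f (a VF.∷ g)))
    ... | a′ , ra′ , head-picked with IH.sum-select (λ i → r (suc i)) (λ g → f (a′ VF.∷ g))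
    ...   | g′ , rg′ , tail-picked = a′ VF.∷ g′ , ∧-intro ra′ rg′ ,
      trans (S.sum-cong split-head) (trans head-picked tail-picked)
      where
        split-head : ∀ a → sumFun s k (λ g → ⟦ eq (r zero) a ∧ eqFun eq k (λ i → r (suc i)) g ⟧ * f (a VF.∷ g))
                         ≡ ⟦ eq (r zero) a ⟧ * sumFun s k (λ g → ⟦ eqFun eq k (λ i → r (suc i)) g ⟧ * f (a VF.∷ g))
        split-head a = trans (IH.sum-cong (λ g → ⟦⟧-∧-* (eq (r zero) a) _ _)) (IH.sum-indicator (eq (r zero) a) _)

sumPair : ∀ {A C : Set} → SumOver A → SumOver C → SumOver (A × C)
sumPair sA sC f = sA (λ a → sC (λ c → f (a , c)))

eqPair : ∀ {A C : Set} → (A → A → Bool) → (C → C → Bool) → A × C → A × C → Bool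
eqPair eqA eqC (a , c) (a′ , c′) = eqA a a′ ∧ eqC c c′

sumPair-selective : ∀ {A C : Set} {sA : SumOver A} {sC : SumOver C} {eqA eqC} →
                    Selective sA eqA → Selective sC eqC → Selective (sumPair sA sC) (eqPair eqA eqC)
sumPair-selective {sA = sA} {sC} {eqA} {eqC} SA SC = record
  { sum-cong   = λ e → SA.sum-cong (λ a → SC.sum-cong (λ c → e (a , c)))
  ; sum-zero   = trans (SA.sum-cong (λ _ → SC.sum-zero)) SA.sum-zero
  ; sum-select = select }
  where
    module SA = Selective SA
    module SC = Selective SC

    select : ∀ r f → ∃ λ p → T (eqPair eqA eqC r p) ×
             sumPair sA sC (λ p → ⟦ eqPair eqA eqC r p ⟧ * f p) ≡ f p
    select (ra , rc) f with SA.sum-select ra (λ a → sC (λ c → ⟦ eqC rc c ⟧ * f (a , c)))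
    ... | a′ , ra′ , first-picked with SC.sum-select rc (λ c → f (a′ , c))
    ...   | c′ , rc′ , second-picked = (a′ , c′) , ∧-intro ra′ rc′ ,
      trans (SA.sum-cong (λ a → trans (SC.sum-cong (λ c → ⟦⟧-∧-* (eqA ra a) _ _)) (SC.sum-indicator (eqA ra a) _)))
            (trans first-picked second-picked)

-- sumLP sums over pairs (R , L) of functions into Bool, and _=ᴸ_ compares
-- them componentwise, so both unfold to the constructions above.
sumLP-selective : ∀ {n} → Selective (sumLP {n}) _=ᴸ_
sumLP-selective {n} =
  sumPair-selective (sumFun-selective (sumFun-selective sumBool-selective n) n)
                    (sumFun-selective sumBool-selective n)

-- Pointwise equality of codes of labelled partitions, decided by _=ᴸ_.  All
-- quantities of the theorem respect it, which is what lets the sum collapse.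

_≐_ : ∀ {n} → LP n → LP n → Set
(R , L) ≐ (R′ , L′) = (∀ x y → R x y ≡ R′ x y) × (∀ x → L x ≡ L′ x)

≐-refl : ∀ {n} (σ : LP n) → σ ≐ σ
≐-refl (R , L) = (λ _ _ → refl) , (λ _ → refl)

=ᴸ-sound : ∀ {n} (σ τ : LP n) → T (σ =ᴸ τ) → σ ≐ τ
=ᴸ-sound (R , L) (R′ , L′) t with ∧-elim {allFin (λ x → allFin (λ y → eqBool (R x y) (R′ x y)))} t
... | same-blocks , same-labels =
  (λ x y → toWitness (all²-elim same-blocks x y)) , (λ x → toWitness (allFin-elim same-labels x))

all²-cong : ∀ {n} {p q : Fin n → Fin n → Bool} → (∀ x y → p x y ≡ q x y) →
            allFin (λ x → allFin (p x)) ≡ allFin (λ x → allFin (q x))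
all²-cong e = allFin-cong (λ x → allFin-cong (e x))

all³-cong : ∀ {n} {p q : Fin n → Fin n → Fin n → Bool} → (∀ x y z → p x y z ≡ q x y z) →
            allFin (λ x → allFin (λ y → allFin (p x y))) ≡ allFin (λ x → allFin (λ y → allFin (q x y)))
all³-cong e = allFin-cong (λ x → all²-cong (e x))

isLP-resp : ∀ {n} (Y : Sub n) (σ τ : LP n) → σ ≐ τ → isLP Y σ ≡ isLP Y τ
isLP-resp Y (R , L) (R′ , L′) (eR , eL) =
  cong₂ _∧_ (all²-cong λ x y → cong (_⇒ᵇ (Y x ∧ Y y)) (eR x y))
  (cong₂ _∧_ (allFin-cong λ x → cong (Y x ⇒ᵇ_) (eR x x))
  (cong₂ _∧_ (all²-cong λ x y → cong₂ _⇒ᵇ_ (eR x y) (eR y x))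
  (cong₂ _∧_ (all³-cong λ x y z → cong₂ _⇒ᵇ_ (cong₂ _∧_ (eR x y) (eR y z)) (eR x z))
  (cong₂ _∧_ (allFin-cong λ x → cong (_⇒ᵇ Y x) (eL x))
             (all²-cong λ x y → cong₂ _⇒ᵇ_ (eR x y) (cong₂ _⇒ᵇ_ (eL x) (eL y)))))))

≤ᴸ-resp : ∀ {n} (π σ τ : LP n) → σ ≐ τ → (π ≤ᴸ σ) ≡ (π ≤ᴸ τ)
≤ᴸ-resp (P , M) (R , L) (R′ , L′) (eR , eL) =
  cong₂ _∧_ (all²-cong λ x y → cong (P x y ⇒ᵇ_) (eR x y)) (allFin-cong λ x → cong (M x ⇒ᵇ_) (eL x))

inΠX-resp : ∀ {n} (K X : Sub n) (σ τ : LP n) → σ ≐ τ → inΠX K X σ ≡ inΠX K X τ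
inΠX-resp K X σ τ e =
  cong₂ _∧_ (isLP-resp X σ τ e) (cong₂ _∧_ (≤ᴸ-resp (πX K X) σ τ e) (anyFin-cong (proj₂ e)))

tclo-cong : ∀ {n} {B B′ : BRel n} → (∀ x y → B x y ≡ B′ x y) → ∀ x y → tclo B x y ≡ tclo B′ x y
tclo-cong {n} = chain-cong n
  where
    chain-cong : ∀ k {B B′ : BRel n} → (∀ x y → B x y ≡ B′ x y) → ∀ x y → chain k B x y ≡ chain k B′ x y
    chain-cong zero    e x y = e x y
    chain-cong (suc k) e x y =
      cong₂ _∨_ (chain-cong k e x y) (anyFin-cong λ z → cong₂ _∧_ (chain-cong k e x z) (e z y))

∨ᴸ-resp : ∀ {n} (σ₁ σ₂ τ₁ τ₂ : LP n) → σ₁ ≐ τ₁ → σ₂ ≐ τ₂ → (σ₁ ∨ᴸ σ₂) ≐ (τ₁ ∨ᴸ τ₂)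
∨ᴸ-resp (R₁ , L₁) (R₂ , L₂) (R₁′ , L₁′) (R₂′ , L₂′) (eR₁ , eL₁) (eR₂ , eL₂) =
  eR , λ x → anyFin-cong λ y → cong₂ _∧_ (eR x y) (cong₂ _∨_ (eL₁ y) (eL₂ y))
  where
    eR : ∀ x y → tclo (λ x y → R₁ x y ∨ R₂ x y) x y ≡ tclo (λ x y → R₁′ x y ∨ R₂′ x y) x y
    eR = tclo-cong (λ x y → cong₂ _∨_ (eR₁ x y) (eR₂ x y))

m-resp : ∀ {n} (σ τ : LP n) → σ ≐ τ → m σ ≡ m τ
m-resp (R , L) (R′ , L′) (eR , eL) =
  cong ⟦_⟧ (cong₂ _∧_ (anyFin-cong eL) (all²-cong λ x y → cong₂ _⇒ᵇ_ (cong₂ _∧_ (eL x) (eL y)) (eR x y)))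

boundary : ∀ {n} → Graph n → Sub n → Sub n → LP n
boundary Gi K X = compLP Gi (K ∩ V Gi) ⊓ X

-- D(Gⁱ,σ) vanishes unless σ is the boundary partition of Gⁱ, so the double
-- sum has a single term.  This holds for any two graphs.
splitSum-collapse : ∀ {n} (G¹ G² : Graph n) (K X : Sub n) →
  splitSum G¹ G² K X ≡ ⟦ inΠX K X (boundary G¹ K X) ∧ inΠX K X (boundary G² K X) ⟧
                       * m (boundary G¹ K X ∨ᴸ boundary G² K X)
splitSum-collapse {n} G¹ G² K X = begin
  splitSum G¹ G² K X
    ≡⟨ LP.sum-cong (λ σ₁ → trans (LP.sum-cong (λ σ₂ → regroup ⟦ inΠX K X σ₁ ∧ inΠX K X σ₂ ⟧
                                                          (D G¹ K X σ₁) (m (σ₁ ∨ᴸ σ₂)) (D G² K X σ₂)))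
                                 (LP.sum-indicator (ρ₁ =ᴸ σ₁) _)) ⟩
  sumLP (λ σ₁ → ⟦ ρ₁ =ᴸ σ₁ ⟧ * sumLP (λ σ₂ → ⟦ ρ₂ =ᴸ σ₂ ⟧ * W σ₁ σ₂))
    ≡⟨ LP.sum-cong (λ σ₁ → cong (⟦ ρ₁ =ᴸ σ₁ ⟧ *_)
         (LP.sum-select-at ρ₂ (W σ₁) λ σ₂ e → W-resp (≐-refl σ₁) (=ᴸ-sound ρ₂ σ₂ e))) ⟩
  sumLP (λ σ₁ → ⟦ ρ₁ =ᴸ σ₁ ⟧ * W σ₁ ρ₂)
    ≡⟨ LP.sum-select-at ρ₁ (λ σ₁ → W σ₁ ρ₂) (λ σ₁ e → W-resp (=ᴸ-sound ρ₁ σ₁ e) (≐-refl ρ₂)) ⟩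
  W ρ₁ ρ₂ ∎
  where
    open ≡-Reasoning
    module LP = Selective (sumLP-selective {n})
    ρ₁ ρ₂ : LP n
    ρ₁ = boundary G¹ K X
    ρ₂ = boundary G² K X

    W : LP n → LP n → ℕ
    W σ₁ σ₂ = ⟦ inΠX K X σ₁ ∧ inΠX K X σ₂ ⟧ * m (σ₁ ∨ᴸ σ₂)

    W-resp : ∀ {σ₁ σ₂ τ₁ τ₂} → σ₁ ≐ τ₁ → σ₂ ≐ τ₂ → W σ₁ σ₂ ≡ W τ₁ τ₂
    W-resp {σ₁} {σ₂} {τ₁} {τ₂} e₁ e₂ =
      cong₂ (λ b k → ⟦ b ⟧ * k) (cong₂ _∧_ (inΠX-resp K X σ₁ τ₁ e₁) (inΠX-resp K X σ₂ τ₂ e₂))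
                                (m-resp (σ₁ ∨ᴸ σ₂) (τ₁ ∨ᴸ τ₂) (∨ᴸ-resp σ₁ σ₂ τ₁ τ₂ e₁ e₂))

    regroup : ∀ a d₁ k d₂ → a * (d₁ * k * d₂) ≡ d₁ * (d₂ * (a * k))
    regroup = solve 4 (λ a d₁ k d₂ → a :* (d₁ :* k :* d₂) := d₁ :* (d₂ :* (a :* k))) refl
      where open +-*-Solver

Joins : ∀ {n} → Fin n × Fin n → Fin n → Fin n → Set
Joins (p , q) x y = (x ≡ p × y ≡ q) ⊎ (x ≡ q × y ≡ p)

data Step {n : ℕ} (H : Graph n) : Fin n → Fin n → Set where
  stay : ∀ {x} → T (V H x) → Step H x x
  edge : ∀ {e x y} → e ∈ E H → Joins e x y → Step H x y

Walk : ∀ {n} → Graph n → Fin n → Fin n → Set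
Walk H = TransClosure (Step H)

step? : ∀ {n} → Graph n → BRel n
step? H x y = (V H x ∧ x == y) ∨ adj H x y

⁺-map : ∀ {A : Set} {R S : A → A → Set} → (∀ {x y} → R x y → S x y) →
        ∀ {x y} → TransClosure R x y → TransClosure S x y
⁺-map f [ r ]   = [ f r ]
⁺-map f (r ∷ w) = f r ∷ ⁺-map f w

anyList-elim : ∀ {A : Set} {p : A → Bool} (l : List A) → T (anyList p l) → ∃ λ a → a ∈ l × T (p a)
anyList-elim {p = p} (a ∷ l) t with ∨-elim {p a} t
... | inj₁ pa = a , here refl , pa
... | inj₂ t′ with anyList-elim l t′
...   | b , b∈l , pb = b , there b∈l , pb

anyList-intro : ∀ {A : Set} {p : A → Bool} {l : List A} {a} → a ∈ l → T (p a) → T (anyList p l)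
anyList-intro {p = p} {a ∷ l} (here refl) t = ∨-introˡ _ t
anyList-intro {p = p} {b ∷ l} (there m)   t = ∨-introʳ (p b) (anyList-intro m t)

step-sound : ∀ {n} (H : Graph n) {x y} → T (step? H x y) → Step H x y
step-sound H {x} {y} t with ∨-elim {V H x ∧ x == y} t
... | inj₁ s with ∧-elim {V H x} s
...   | v , x=y rewrite ==-sound x=y = stay v
step-sound H {x} {y} t | inj₂ a with anyList-elim (E H) a
... | (p , q) , m , j with ∨-elim {x == p ∧ y == q} j
...   | inj₁ j₁ = let (xp , yq) = ∧-elim {x == p} j₁ in edge m (inj₁ (==-sound xp , ==-sound yq))
...   | inj₂ j₂ = let (xq , yp) = ∧-elim {x == q} j₂ in edge m (inj₂ (==-sound xq , ==-sound yp))

step-complete : ∀ {n} (H : Graph n) {x y} → Step H x y → T (step? H x y)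
step-complete H {x} (stay v) = ∨-introˡ _ (∧-intro v (==-refl x))
step-complete H {x} {y} (edge m (inj₁ (refl , refl))) =
  ∨-introʳ (V H x ∧ x == y) (anyList-intro m (∨-introˡ _ (∧-intro (==-refl x) (==-refl y))))
step-complete H {x} {y} (edge m (inj₂ (refl , refl))) =
  ∨-introʳ (V H x ∧ x == y) (anyList-intro m (∨-introʳ (x == y ∧ y == x) (∧-intro (==-refl x) (==-refl y))))

conn-sound : ∀ {n} (H : Graph n) {x y} → T (conn H x y) → Walk H x y
conn-sound H t = ⁺-map (step-sound H) (Closure.tclo-sound (step? H) t)

conn-complete : ∀ {n} (H : Graph n) {x y} → Walk H x y → T (conn H x y)
conn-complete H w = Closure.tclo-complete (step? H) (⁺-map (step-complete H) w)

walk-sym : ∀ {n} {H : Graph n} {x y} → Walk H x y → Walk H y x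
walk-sym {H = H} = symmetric (Step H) step-sym
  where
    step-sym : ∀ {x y} → Step H x y → Step H y x
    step-sym (stay v)                   = stay v
    step-sym (edge m (inj₁ (xp , yq))) = edge m (inj₂ (yq , xp))
    step-sym (edge m (inj₂ (xq , yp))) = edge m (inj₁ (yp , xq))

joins-ends : ∀ {n} {H : Graph n} → IsGraph H → ∀ {e x y} → e ∈ E H → Joins e x y → T (V H x) × T (V H y)
joins-ends g m j with All-lookup g m
joins-ends g m (inj₁ (refl , refl)) | vp , vq , _ = vp , vq
joins-ends g m (inj₂ (refl , refl)) | vp , vq , _ = vq , vp

walk-ends : ∀ {n} {H : Graph n} → IsGraph H → ∀ {x y} → Walk H x y → T (V H x) × T (V H y)
walk-ends {H = H} g = ⁺-ends
  where
    step-ends : ∀ {x y} → Step H x y → T (V H x) × T (V H y)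
    step-ends (stay v)   = v , v
    step-ends (edge m j) = joins-ends g m j
    ⁺-ends : ∀ {x y} → Walk H x y → T (V H x) × T (V H y)
    ⁺-ends [ s ]   = step-ends s
    ⁺-ends (s ∷ w) = proj₁ (step-ends s) , proj₂ (⁺-ends w)

walk-mono : ∀ {n} {H H′ : Graph n} → V H ⊆ V H′ → (∀ {e} → e ∈ E H → e ∈ E H′) →
            ∀ {x y} → Walk H x y → Walk H′ x y
walk-mono sv se = ⁺-map λ { (stay v) → stay (sv _ v) ; (edge m j) → edge (se m) j }

linked : ∀ {n} → Graph n → Sub n → Bool
linked H K′ = allFin (λ x → allFin (λ y → (K′ x ∧ K′ y) ⇒ᵇ conn H x y))

Linked : ∀ {n} → Graph n → Sub n → Set
Linked H K′ = ∀ {x y} → T (K′ x) → T (K′ y) → Walk H x y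

linked-sound : ∀ {n} (H : Graph n) K′ → T (linked H K′) → Linked H K′
linked-sound H K′ t {x} {y} kx ky = conn-sound H (⇒-elim (all²-elim t x y) (∧-intro kx ky))

linked-complete : ∀ {n} (H : Graph n) K′ → Linked H K′ → T (linked H K′)
linked-complete H K′ l = all²-intro λ x y → ⇒-intro λ k →
  let (kx , ky) = ∧-elim {K′ x} k in conn-complete H (l kx ky)

-- A splitting of G along X into Gi and Gj, as used by the proof.  It is
-- symmetric in (Gi , Gj), so every one-sided lemma applies to both sides.

record Split {n : ℕ} (G Gi Gj : Graph n) (X : Sub n) : Set where
  field
    graphᵢ     : IsGraph Gi
    graphⱼ     : IsGraph Gj
    subᵢ       : V Gi ⊆ V G
    subⱼ       : V Gj ⊆ V G
    edge-split : ∀ {e} → e ∈ E G → e ∈ E Gi ⊎ e ∈ E Gj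
    edgeᵢ      : ∀ {e} → e ∈ E Gi → e ∈ E G
    edgeⱼ      : ∀ {e} → e ∈ E Gj → e ∈ E G
    vertex-split : ∀ x → T (V G x) → T (V Gi x) ⊎ T (V Gj x)
    X-both     : ∀ x → T (X x) → T (V Gi x) × T (V Gj x)
    both-X     : ∀ x → T (V Gi x) → T (V Gj x) → T (X x)

swap-split : ∀ {n} {G Gi Gj : Graph n} {X} → Split G Gi Gj X → Split G Gj Gi X
swap-split S = record
  { graphᵢ = graphⱼ ; graphⱼ = graphᵢ ; subᵢ = subⱼ ; subⱼ = subᵢ
  ; edge-split = λ m → swap (edge-split m) ; edgeᵢ = edgeⱼ ; edgeⱼ = edgeᵢ
  ; vertex-split = λ x v → swap (vertex-split x v)
  ; X-both = λ x t → proj₂ (X-both x t) , proj₁ (X-both x t)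
  ; both-X = λ x vj vi → both-X x vi vj }
  where open Split S

KSplitting⇒Split : ∀ {n} {G G¹ G² : Graph n} {K X} → KSplitting G K G¹ G² X → Split G G¹ G² X
KSplitting⇒Split {G¹ = G¹} {G²} {K} {X} ks = record
  { graphᵢ = graph¹ ; graphⱼ = graph² ; subᵢ = sub¹ ; subⱼ = sub²
  ; edge-split = λ m → ∈-++⁻ (E G¹) (∈-resp-↭ edges m)
  ; edgeᵢ = λ m → ∈-resp-↭ (↭-sym edges) (∈-++⁺ˡ m)
  ; edgeⱼ = λ m → ∈-resp-↭ (↭-sym edges) (∈-++⁺ʳ (E G¹) m)
  ; vertex-split = λ x v → ∨-elim (subst T (vunion x) v)
  ; X-both = λ x t → ∧-elim (subst T (vinter x) t)
  ; both-X = λ x v¹ v² → subst T (sym (vinter x)) (∧-intro v¹ v²) }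
  where open KSplitting ks

module Contraction {n : ℕ} {G Gi Gj : Graph n} {X : Sub n} (S : Split G Gi Gj X) where
  open Split S

  C : Graph (suc n)
  C = contract Gi X

  Outside : Fin n → Set
  Outside x = T (V Gi x) × ¬ T (X x)

  ReachesX : Fin n → Set
  ReachesX u = ∃ λ x → T (X x) × Walk Gi u x

  kept? : (e : Fin n × Fin n) → Dec ((X (proj₁ e) ∧ X (proj₂ e)) ≡ false)
  kept? e = (X (proj₁ e) ∧ X (proj₂ e)) Bool.≟ false

  cmap-in : ∀ {x} → T (X x) → cmap X x ≡ zero
  cmap-in {x} t rewrite Equivalence.to T-≡ t = refl

  cmap-out : ∀ {x} → ¬ T (X x) → cmap X x ≡ suc x
  cmap-out {x} f rewrite Equivalence.to T-not-≡ (not-intro f) = refl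

  suc≡cmap : ∀ {u x} → suc u ≡ cmap X x → u ≡ x
  suc≡cmap {x = x} eq with T? (X x)
  ... | inj₁ t with trans eq (cmap-in t)
  ...   | ()
  suc≡cmap eq | inj₂ f = suc-injective (trans eq (cmap-out f))

  contract-step : ∀ {e x y} → e ∈ E Gi → Joins e x y → ¬ T (X x) → Step C (cmap X x) (cmap X y)
  contract-step {p , q} {x} {y} m j ¬x = edge (∈-map⁺ _ (∈-filter⁺ kept? m (kept j))) (lemma j)
    where
      kept : Joins (p , q) x y → (X p ∧ X q) ≡ false
      kept (inj₁ (refl , _)) = Equivalence.to T-not-≡ (not-intro λ t → ¬x (proj₁ (∧-elim {X p} t)))
      kept (inj₂ (refl , _)) = Equivalence.to T-not-≡ (not-intro λ t → ¬x (proj₂ (∧-elim {X p} t)))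
      lemma : ∀ {x y} → Joins (p , q) x y → Joins (cmap X p , cmap X q) (cmap X x) (cmap X y)
      lemma (inj₁ (refl , refl)) = inj₁ (refl , refl)
      lemma (inj₂ (refl , refl)) = inj₂ (refl , refl)

  contract-edge⁻ : ∀ {e′} → e′ ∈ E C → ∃ λ e → e ∈ E Gi × e′ ≡ (cmap X (proj₁ e) , cmap X (proj₂ e))
  contract-edge⁻ m with ∈-map⁻ _ m
  ... | e , m′ , refl = e , proj₁ (∈-filter⁻ kept? m′) , refl

  -- One step of G from Gi \ X either enters X or stays in Gi \ X; it cannot
  -- use an edge of Gj, whose endpoints would lie in X.
  leave-step : ∀ {u y} → Outside u → Step G u y →
               Walk C (suc u) zero ⊎ (Outside y × Walk C (suc u) (suc y))
  leave-step (vu , ¬xu) (stay _) = inj₂ ((vu , ¬xu) , [ stay (∧-intro vu (not-intro ¬xu)) ])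
  leave-step {u} {y} (vu , ¬xu) (edge m j) with edge-split m
  ... | inj₂ mⱼ = ⊥-elim (¬xu (both-X u vu (proj₁ (joins-ends graphⱼ mⱼ j))))
  ... | inj₁ mᵢ with T? (X y)
  ...   | inj₁ xy  = inj₁ [ subst₂ (Step C) (cmap-out ¬xu) (cmap-in xy) (contract-step mᵢ j ¬xu) ]
  ...   | inj₂ ¬xy = inj₂ ( (proj₂ (joins-ends graphᵢ mᵢ j) , ¬xy)
                          , [ subst₂ (Step C) (cmap-out ¬xu) (cmap-out ¬xy) (contract-step mᵢ j ¬xu) ] )

  leave : ∀ {u w} → Outside u → Walk G u w →
          Walk C (suc u) zero ⊎ (Outside w × Walk C (suc u) (suc w))
  leave o [ s ] = leave-step o s
  leave o (s ∷ w) with leave-step o s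
  ... | inj₁ c = inj₁ c
  ... | inj₂ (o′ , c) with leave o′ w
  ...   | inj₁ d        = inj₁ (c ++ d)
  ...   | inj₂ (o″ , d) = inj₂ (o″ , c ++ d)

  lift-edge : ∀ {e u x y b} → e ∈ E Gi → Joins e x y → suc u ≡ cmap X x → b ≡ cmap X y →
              ReachesX u ⊎ ∃ λ w → b ≡ suc w × Walk Gi u w
  lift-edge {y = y} m j u≡x b≡y with suc≡cmap u≡x | T? (X y)
  ... | refl | inj₁ xy  = inj₁ (y , xy , [ edge m j ])
  ... | refl | inj₂ ¬xy = inj₂ (y , trans b≡y (cmap-out ¬xy) , [ edge m j ])

  lift-step : ∀ {u b} → Step C (suc u) b → ReachesX u ⊎ ∃ λ w → b ≡ suc w × Walk Gi u w
  lift-step {u} (stay v) = inj₂ (u , refl , [ stay (proj₁ (∧-elim {V Gi u} v)) ])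
  lift-step (edge m j) with contract-edge⁻ m
  ... | (p , q) , mᵢ , refl with j
  ...   | inj₁ (u≡p , b≡q) = lift-edge mᵢ (inj₁ (refl , refl)) u≡p b≡q
  ...   | inj₂ (u≡q , b≡p) = lift-edge mᵢ (inj₂ (refl , refl)) u≡q b≡p

  lift : ∀ {u b} → Walk C (suc u) b → ReachesX u ⊎ ∃ λ w → b ≡ suc w × Walk Gi u w
  lift [ s ] = lift-step s
  lift (s ∷ w) with lift-step s
  ... | inj₁ r = inj₁ r
  ... | inj₂ (v , refl , c) with lift w
  ...   | inj₁ (x , xx , d) = inj₁ (x , xx , c ++ d)
  ...   | inj₂ (w′ , eq , d) = inj₂ (w′ , eq , c ++ d)

  lift-to-X : ∀ {u} → Walk C (suc u) zero → ReachesX u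
  lift-to-X c with lift c
  ... | inj₁ r = r
  ... | inj₂ (_ , () , _)

module Boundary {n : ℕ} {G Gi Gj : Graph n} (K : Sub n) {X : Sub n} (S : Split G Gi Gj X) where
  open Split S
  open Contraction S

  ρ : LP n
  ρ = boundary Gi K X

  Block : BRel n
  Block = proj₁ ρ

  Label : Sub n
  Label = proj₂ ρ

  block-elim : ∀ {x y} → T (Block x y) → Walk Gi x y × T (X x) × T (X y)
  block-elim {x} {y} t with ∧-elim {V Gi x ∧ V Gi y ∧ conn Gi x y} t
  ... | b , xs with ∧-elim {X x} xs
  ...   | xx , xy = conn-sound Gi (proj₂ (∧-elim {V Gi y} (proj₂ (∧-elim {V Gi x} b)))) , xx , xy

  block-intro : ∀ {x y} → Walk Gi x y → T (X x) → T (X y) → T (Block x y)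
  block-intro c xx xy =
    let (vx , vy) = walk-ends graphᵢ c
    in ∧-intro (∧-intro vx (∧-intro vy (conn-complete Gi c))) (∧-intro xx xy)

  block-refl : ∀ {x} → T (X x) → T (Block x x)
  block-refl {x} xx = block-intro [ stay (proj₁ (X-both x xx)) ] xx xx

  label-elim : ∀ {x} → T (Label x) → T (X x) × ∃ λ k → T (K k) × Walk Gi x k
  label-elim {x} t with ∧-elim {V Gi x ∧ anyFin (λ k → (K ∩ V Gi) k ∧ conn Gi x k)} t
  ... | l , xx with anyFin-elim {p = λ k → (K ∩ V Gi) k ∧ conn Gi x k} (proj₂ (∧-elim {V Gi x} l))
  ...   | k , u with ∧-elim {(K ∩ V Gi) k} u
  ...     | kk , c = xx , k , proj₁ (∧-elim {K k} kk) , conn-sound Gi c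

  label-intro : ∀ {x k} → T (X x) → T (K k) → Walk Gi x k → T (Label x)
  label-intro {x} {k} xx kk c =
    let (vx , vk) = walk-ends graphᵢ c
    in ∧-intro (∧-intro vx (anyFin-intro k (∧-intro (∧-intro kk vk) (conn-complete Gi c)))) xx

  boundary-isLP : T (isLP X ρ)
  boundary-isLP = ∧-intro within (∧-intro reflexive (∧-intro symmetric′ (∧-intro transitive′
                    (∧-intro labels-within labels-closed))))
    where
      within : T (allFin (λ x → allFin (λ y → Block x y ⇒ᵇ (X x ∧ X y))))
      within = all²-intro {n} λ x y → ⇒-intro λ t → let (_ , xx , xy) = block-elim t in ∧-intro xx xy

      reflexive : T (allFin (λ x → X x ⇒ᵇ Block x x))
      reflexive = allFin-intro {n} λ x → ⇒-intro block-refl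

      symmetric′ : T (allFin (λ x → allFin (λ y → Block x y ⇒ᵇ Block y x)))
      symmetric′ = all²-intro {n} λ x y → ⇒-intro λ t →
        let (c , xx , xy) = block-elim t in block-intro (walk-sym c) xy xx

      transitive′ : T (allFin (λ x → allFin (λ y → allFin (λ z → (Block x y ∧ Block y z) ⇒ᵇ Block x z))))
      transitive′ = allFin-intro {n} λ x → all²-intro {n} λ y z → ⇒-intro λ t →
        let (c , xx , _) = block-elim (proj₁ (∧-elim {Block x y} t))
            (d , _ , xz) = block-elim (proj₂ (∧-elim {Block x y} t))
        in block-intro (c ++ d) xx xz

      labels-within : T (allFin (λ x → Label x ⇒ᵇ X x))
      labels-within = allFin-intro {n} λ x → ⇒-intro λ t → proj₁ (label-elim t)

      labels-closed : T (allFin (λ x → allFin (λ y → Block x y ⇒ᵇ (Label x ⇒ᵇ Label y))))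
      labels-closed = all²-intro {n} λ x y → ⇒-intro λ t → ⇒-intro λ l →
        let (c , _ , xy) = block-elim t
            (_ , k , kK , d) = label-elim l
        in label-intro xy kK (walk-sym c ++ d)

  πX≤boundary : T (πX K X ≤ᴸ ρ)
  πX≤boundary = ∧-intro singletons terminals
    where
      singletons : T (allFin (λ x → allFin (λ y → (X x ∧ x == y) ⇒ᵇ Block x y)))
      singletons = all²-intro {n} λ x y → ⇒-intro λ t →
        let (xx , x=y) = ∧-elim {X x} t in subst (λ z → T (Block x z)) (==-sound x=y) (block-refl xx)

      terminals : T (allFin (λ x → (X x ∧ K x) ⇒ᵇ Label x))
      terminals = allFin-intro {n} λ x → ⇒-intro λ t →
        let (xx , kx) = ∧-elim {X x} t in label-intro xx kx [ stay (proj₁ (X-both x xx)) ]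

  Tᵢ : Sub (suc n)
  Tᵢ = termX (K ∩ V Gi) X

  -- If a terminal kⱼ lies on the other side, every terminal of Gi_X reaches
  -- the contracted vertex: its walk to kⱼ in G must cross X.
  terminals-linked : ∀ {kⱼ} → T (K kⱼ) → T (V Gj kⱼ) → Linked G K → Linked C Tᵢ
  terminals-linked {kⱼ} kⱼK kⱼV linkedG ta tb = to-zero _ ta ++ walk-sym (to-zero _ tb)
    where
      to-zero : ∀ a → T (Tᵢ a) → Walk C a zero
      to-zero zero    _ = [ stay tt ]
      to-zero (suc k) t with ∧-elim {(K ∩ V Gi) k} t
      ... | kk , ¬xk with ∧-elim {K k} kk
      ...   | kK , kV with leave (kV , not-elim ¬xk) (linkedG kK kⱼK)
      ...     | inj₁ c                = c
      ...     | inj₂ ((kⱼVᵢ , ¬xkⱼ) , _) = ⊥-elim (¬xkⱼ (both-X kⱼ kⱼVᵢ kⱼV))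

  terminal-labelled : Linked C Tᵢ → ∀ {k} → T (K k) → T (V Gi k) → ∃ λ x → T (Label x) × Walk Gi k x
  terminal-labelled linkedC {k} kK kV with T? (X k)
  ... | inj₁ xk  = k , label-intro xk kK [ stay kV ] , [ stay kV ]
  ... | inj₂ ¬xk with lift-to-X (linkedC {suc k} {zero} (∧-intro (∧-intro kK kV) (not-intro ¬xk)) tt)
  ...   | x , xx , c = x , label-intro xx kK (walk-sym c) , c

  boundary-in-Π : Linked C Tᵢ → ∀ {k} → T (K k) → T (V Gi k) → T (inΠX K X ρ)
  boundary-in-Π linkedC kK kV =
    let (x , lx , _) = terminal-labelled linkedC kK kV
    in ∧-intro boundary-isLP (∧-intro πX≤boundary (anyFin-intro x lx))

-- Two vertices of X share a
-- block of the join iff they are joined by a walk of G: a walk between points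
-- of X splits at its visits to X into pieces inside G¹ or inside G².

module Join {n : ℕ} {G G¹ G² : Graph n} (K : Sub n) {X : Sub n} (S : Split G G¹ G² X) where
  open Split S
  module B₁ = Boundary K S
  module B₂ = Boundary K (swap-split S)

  Link : BRel n
  Link x y = B₁.Block x y ∨ B₂.Block x y

  Joined : Fin n → Fin n → Set
  Joined = Closure.Walk Link

  link₁ : ∀ {x y} → Walk G¹ x y → T (X x) → T (X y) → T (Link x y)
  link₁ c xx xy = ∨-introˡ _ (B₁.block-intro c xx xy)

  link₂ : ∀ {x y} → Walk G² x y → T (X x) → T (X y) → T (Link x y)
  link₂ {x} {y} c xx xy = ∨-introʳ (B₁.Block x y) (B₂.block-intro c xx xy)

  link-elim : ∀ {x y} → T (Link x y) → Walk G x y × T (X x)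
  link-elim {x} {y} t with ∨-elim {B₁.Block x y} t
  ... | inj₁ b = let (c , xx , _) = B₁.block-elim b in walk-mono subᵢ edgeᵢ c , xx
  ... | inj₂ b = let (c , xx , _) = B₂.block-elim b in walk-mono subⱼ edgeⱼ c , xx

  joined-walk : ∀ {x y} → Joined x y → Walk G x y × T (X x)
  joined-walk [ l ]   = link-elim l
  joined-walk (l ∷ j) = let (c , xx) = link-elim l in c ++ proj₁ (joined-walk j) , xx

  -- A walk from w to z ∈ X, seen from w: it reaches some x₀ ∈ X inside one
  -- side, and x₀ is joined to z.
  Approach : Fin n → Fin n → Set
  Approach w z = ∃ λ x₀ → T (X x₀) × Joined x₀ z × (Walk G¹ w x₀ ⊎ Walk G² w x₀)

  approach-end : ∀ {z} → T (X z) → Approach z z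
  approach-end {z} xz = z , xz , [ link₁ [ stay v¹ ] xz xz ] , inj₁ [ stay v¹ ]
    where
      v¹ : T (V G¹ z)
      v¹ = proj₁ (X-both z xz)

  -- Prepending a step keeps the approach; switching sides happens at a vertex
  -- of both sides, which lies in X.
  approach-step : ∀ {w y z} → Step G w y → Approach y z → Approach w z
  approach-step (stay _) a = a
  approach-step {y = y} (edge m j) (x₀ , xx₀ , J , side) with edge-split m | side
  ... | inj₁ m₁ | inj₁ c₁ = x₀ , xx₀ , J , inj₁ (edge m₁ j ∷ c₁)
  ... | inj₂ m₂ | inj₂ c₂ = x₀ , xx₀ , J , inj₂ (edge m₂ j ∷ c₂)
  ... | inj₁ m₁ | inj₂ c₂ =
    let xy = both-X y (proj₂ (joins-ends graphᵢ m₁ j)) (proj₁ (walk-ends graphⱼ c₂))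
    in y , xy , link₂ c₂ xy xx₀ ∷ J , inj₁ [ edge m₁ j ]
  ... | inj₂ m₂ | inj₁ c₁ =
    let xy = both-X y (proj₁ (walk-ends graphᵢ c₁)) (proj₂ (joins-ends graphⱼ m₂ j))
    in y , xy , link₁ c₁ xy xx₀ ∷ J , inj₂ [ edge m₂ j ]

  approach : ∀ {w z} → T (X z) → Walk G w z → Approach w z
  approach xz [ s ]   = approach-step s (approach-end xz)
  approach xz (s ∷ c) = approach-step s (approach xz c)

  walk-joined : ∀ {x z} → T (X x) → Walk G x z → T (X z) → Joined x z
  walk-joined xx c xz with approach xz c
  ... | x₀ , xx₀ , J , inj₁ c₁ = link₁ c₁ xx xx₀ ∷ J
  ... | x₀ , xx₀ , J , inj₂ c₂ = link₂ c₂ xx xx₀ ∷ J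

  joined-refl : ∀ {x} → T (X x) → T (tclo Link x x)
  joined-refl {x} xx = Closure.tclo-complete Link [ link₁ [ stay (proj₁ (X-both x xx)) ] xx xx ]

  JLabel : Sub n
  JLabel = proj₂ (B₁.ρ ∨ᴸ B₂.ρ)

  jlabel-elim : ∀ {x} → T (JLabel x) → T (X x) × ∃ λ k → T (K k) × Walk G x k
  jlabel-elim {x} t with anyFin-elim {p = λ y → tclo Link x y ∧ (B₁.Label y ∨ B₂.Label y)} t
  ... | y , u with ∧-elim {tclo Link x y} u
  ...   | xy , ly with joined-walk (Closure.tclo-sound Link xy) | ∨-elim {B₁.Label y} ly
  ...     | c , xx | inj₁ l = let (_ , k , kK , d) = B₁.label-elim l in xx , k , kK , c ++ walk-mono subᵢ edgeᵢ d
  ...     | c , xx | inj₂ l = let (_ , k , kK , d) = B₂.label-elim l in xx , k , kK , c ++ walk-mono subⱼ edgeⱼ d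

  jlabel-intro₁ : ∀ {x} → T (B₁.Label x) → T (JLabel x)
  jlabel-intro₁ {x} l = anyFin-intro x (∧-intro (joined-refl (proj₁ (B₁.label-elim l))) (∨-introˡ _ l))

  jlabel-intro₂ : ∀ {x} → T (B₂.Label x) → T (JLabel x)
  jlabel-intro₂ {x} l = anyFin-intro x (∧-intro (joined-refl (proj₁ (B₂.label-elim l))) (∨-introʳ (B₁.Label x) l))

oneLabelled : ∀ {n} → LP n → Bool
oneLabelled (R , L) = anyFin L ∧ allFin (λ x → allFin (λ y → (L x ∧ L y) ⇒ᵇ R x y))

module Connectivity {n : ℕ} {G G¹ G² : Graph n} (K : Sub n) {X : Sub n} (S : Split G G¹ G² X) where
  open Split S
  open Join K S

  ρ₁ ρ₂ : LP n
  ρ₁ = B₁.ρ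
  ρ₂ = B₂.ρ

  C₁ C₂ : Graph (suc n)
  C₁ = contract G¹ X
  C₂ = contract G² X

  T₁ T₂ : Sub (suc n)
  T₁ = B₁.Tᵢ
  T₂ = B₂.Tᵢ

  -- If K is connected in G, each side's terminals reach X (through the
  -- terminal on the other side), and all labelled blocks are joined through K.
  forward : ∀ {k₁ k₂} → T (K k₁) → T (V G¹ k₁) → T (K k₂) → T (V G² k₂) → Linked G K →
            Linked C₁ T₁ × Linked C₂ T₂ ×
            T (inΠX K X ρ₁) × T (inΠX K X ρ₂) × T (oneLabelled (ρ₁ ∨ᴸ ρ₂))
  forward k₁K k₁V k₂K k₂V linkedG =
    linked₁ , linked₂ , B₁.boundary-in-Π linked₁ k₁K k₁V , B₂.boundary-in-Π linked₂ k₂K k₂V ,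
    ∧-intro some-label all-joined
    where
      linked₁ : Linked C₁ T₁
      linked₁ = B₁.terminals-linked k₂K k₂V linkedG
      linked₂ : Linked C₂ T₂
      linked₂ = B₂.terminals-linked k₁K k₁V linkedG

      some-label : T (anyFin JLabel)
      some-label = let (x , lx , _) = B₁.terminal-labelled linked₁ k₁K k₁V in anyFin-intro x (jlabel-intro₁ lx)

      -- Labelled points reach K, and K is connected in G.
      all-joined : T (allFin (λ x → allFin (λ y → (JLabel x ∧ JLabel y) ⇒ᵇ tclo Link x y)))
      all-joined = all²-intro {n} λ x y → ⇒-intro λ t →
        let (xx , k , kK , c)   = jlabel-elim (proj₁ (∧-elim {JLabel x} t))
            (xy , k′ , k′K , c′) = jlabel-elim (proj₂ (∧-elim {JLabel x} t))
        in Closure.tclo-complete Link (walk-joined xx (c ++ linkedG kK k′K ++ walk-sym c′) xy)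

  -- Conversely each terminal reaches a labelled block of the join, and these
  -- all coincide, so any two terminals are joined in G.
  backward : K ⊆ V G → Linked C₁ T₁ → Linked C₂ T₂ → T (oneLabelled (ρ₁ ∨ᴸ ρ₂)) → Linked G K
  backward K⊆V linked₁ linked₂ one {a} {b} aK bK =
    let (x , lx , cx) = labelled aK
        (y , ly , cy) = labelled bK
        xy = ⇒-elim (all²-elim (proj₂ (∧-elim {anyFin JLabel} one)) x y) (∧-intro lx ly)
    in cx ++ proj₁ (joined-walk (Closure.tclo-sound Link xy)) ++ walk-sym cy
    where
      labelled : ∀ {k} → T (K k) → ∃ λ x → T (JLabel x) × Walk G k x
      labelled {k} kK with vertex-split k (K⊆V k kK)
      ... | inj₁ v¹ = let (x , l , c) = B₁.terminal-labelled linked₁ kK v¹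
                      in x , jlabel-intro₁ l , walk-mono subᵢ edgeᵢ c
      ... | inj₂ v² = let (x , l , c) = B₂.terminal-labelled linked₂ kK v²
                      in x , jlabel-intro₂ l , walk-mono subⱼ edgeⱼ c

  M-factorises : (∃ λ k → T ((K ∩ V G¹) k)) → (∃ λ k → T ((K ∩ V G²) k)) → K ⊆ V G →
                 M G K ≡ M C₁ T₁ * M C₂ T₂ * (⟦ inΠX K X ρ₁ ∧ inΠX K X ρ₂ ⟧ * m (ρ₁ ∨ᴸ ρ₂))
  M-factorises (k₁ , t₁) (k₂ , t₂) K⊆V =
    ⟦⟧-factorise {linked G K} {linked C₁ T₁} {linked C₂ T₂} {inΠX K X ρ₁ ∧ inΠX K X ρ₂} {oneLabelled (ρ₁ ∨ᴸ ρ₂)}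
      to from
    where
      to : T (linked G K) → T (linked C₁ T₁) × T (linked C₂ T₂) ×
                            T (inΠX K X ρ₁ ∧ inΠX K X ρ₂) × T (oneLabelled (ρ₁ ∨ᴸ ρ₂))
      to t =
        let (k₁K , k₁V) = ∧-elim {K k₁} t₁
            (k₂K , k₂V) = ∧-elim {K k₂} t₂
            (L₁ , L₂ , I₁ , I₂ , O) = forward k₁K k₁V k₂K k₂V (linked-sound G K t)
        in linked-complete C₁ T₁ L₁ , linked-complete C₂ T₂ L₂ , ∧-intro {inΠX K X ρ₁} {inΠX K X ρ₂} I₁ I₂ , O

      from : T (linked C₁ T₁) × T (linked C₂ T₂) × T (inΠX K X ρ₁ ∧ inΠX K X ρ₂) × T (oneLabelled (ρ₁ ∨ᴸ ρ₂)) →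
             T (linked G K)
      from (L₁ , L₂ , _ , O) = linked-complete G K (backward K⊆V (linked-sound C₁ T₁ L₁) (linked-sound C₂ T₂ L₂) O)

theorem5p15 : {n : ℕ} (G G¹ G² : Graph n) (K X : Sub n) →
    IsGraph G → K ⊆ V G →
    Σ (Fin n) (λ x → Σ (Fin n) (λ y → x ≢ y × T (K x) × T (K y))) →
    KSplitting G K G¹ G² X →
    M G K ≡ M (contract G¹ X) (termX (K ∩ V G¹) X)
            * M (contract G² X) (termX (K ∩ V G²) X)
            * splitSum G¹ G² K X
theorem5p15 G G¹ G² K X _ K⊆V _ ks = begin
  M G K
    ≡⟨ M-factorises K¹-ne K²-ne K⊆V ⟩
  M C₁ T₁ * M C₂ T₂ * (⟦ inΠX K X ρ₁ ∧ inΠX K X ρ₂ ⟧ * m (ρ₁ ∨ᴸ ρ₂))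
    ≡⟨ cong (M C₁ T₁ * M C₂ T₂ *_) (sym (splitSum-collapse G¹ G² K X)) ⟩
  M C₁ T₁ * M C₂ T₂ * splitSum G¹ G² K X ∎
  where
    open ≡-Reasoning
    open KSplitting ks using (K¹-ne; K²-ne)
    open Connectivity K (KSplitting⇒Split ks)
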